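{- Let $d=(d_1,\dots,d_n)$ be a degree sequence and let $\overline{d}=(n-1-d_n,\dots,n-1-d_1)$ be its complementary sequence (the degree sequence of the complement of any realization of $d$). Then $M(\overline{d})=M(d)_\bot$.
   Context: A degree sequence is written in nonincreasing order. The corrected Ferrers diagram $F(d)$ is the $n\times n$ matrix with stars on the main diagonal in which, for each $i$, the first $d_i$ non-diagonal entries of row $i$ equal $1$ and all other non-diagonal entries equal $0$; stars have numerical value $0$ in matrix arithmetic (and transposes keep stars on the diagonal). The (Erdős–Gallai) difference matrix is $M(d)=F(d)^T-F(d)$. For an $m\times n$ matrix $M$ with entries $M_{i,j}$, the antidiagonal transpose $M_\bot$ is the $n\times m$ matrix with $(M_\bot)_{i',j'}=M_{m+1-j',\,n+1-i'}$. -}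

module Defs where

open import Data.Nat using (ℕ; zero; suc; _∸_; _<_; _≤_) renaming (_<ᵇ_ to _<ᵇℕ_)
open import Data.Integer using (ℤ; +_; _-_)
open import Data.Fin using (Fin; toℕ; opposite) renaming (_≤_ to _≤ᶠ_)
open import Data.Fin.Properties using () renaming (_≟_ to _≟ᶠ_)
open import Data.Bool using (Bool; true; false; if_then_else_)
open import Data.List using (List; map; allFin)
open import Data.Nat.ListAction using (sum)
open import Data.Product using (Σ; _×_)
open import Relation.Binary.PropositionalEquality using (_≡_)
open import Relation.Nullary using (yes; no)

record SimpleGraph (n : ℕ) : Set where
  field
    adj   : Fin n → Fin n → Bool
    sym   : ∀ i j → adj i j ≡ adj j i
    loopless : ∀ i → adj i i ≡ false

open SimpleGraph public

degree : ∀ {n} → SimpleGraph n → Fin n → ℕ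
degree {n} G i = sum (map (λ j → if adj G i j then 1 else 0) (allFin n))

-- sequences are indexed 0..n-1 (0-based version of d_1..d_n)
Seq : ℕ → Set
Seq n = Fin n → ℕ

NonIncreasing : ∀ {n} → Seq n → Set
NonIncreasing {n} d = ∀ (i j : Fin n) → i ≤ᶠ j → d j ≤ d i

Realizes : ∀ {n} → SimpleGraph n → Seq n → Set
Realizes {n} G d = ∀ (i : Fin n) → degree G i ≡ d i

IsDegreeSequence : ∀ {n} → Seq n → Set
IsDegreeSequence {n} d = NonIncreasing d × Σ (SimpleGraph n) (λ G → Realizes G d)

-- complementary sequence: dbar_i = n-1-d_{n+1-i} (1-based)
complement : ∀ {n} → Seq n → Seq n
complement {n} d i = (n ∸ 1) ∸ d (opposite i)

-- matrix entries: a star or a number (star has value 0 in arithmetic)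
data Entry : Set where
  star : Entry
  num  : ℤ → Entry

value : Entry → ℤ
value star    = + 0
value (num z) = z

-- difference of entries; star - star = star (the diagonal stays starred)
_-ᵉ_ : Entry → Entry → Entry
star -ᵉ star = star
x    -ᵉ y    = num (value x - value y)

Matrix : ℕ → ℕ → Set
Matrix m n = Fin m → Fin n → Entry

-- 0-based position of column j among the non-diagonal entries of row i
offDiagPos : ∀ {n} → Fin n → Fin n → ℕ
offDiagPos i j with toℕ j <ᵇℕ toℕ i
... | true  = toℕ j
... | false = toℕ j ∸ 1

ferrers : ∀ {n} → Seq n → Matrix n n
ferrers d i j with i ≟ᶠ j
... | yes _ = star
... | no  _ = if offDiagPos i j <ᵇℕ d i then num (+ 1) else num (+ 0)

transpose : ∀ {m n} → Matrix m n → Matrix n m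
transpose M i j = M j i

_-ᴹ_ : ∀ {m n} → Matrix m n → Matrix m n → Matrix m n
(A -ᴹ B) i j = A i j -ᵉ B i j

diffMatrix : ∀ {n} → Seq n → Matrix n n
diffMatrix d = transpose (ferrers d) -ᴹ ferrers d

antiTranspose : ∀ {m n} → Matrix m n → Matrix n m
antiTranspose M i′ j′ = M (opposite j′) (opposite i′)

_≡ᴹ_ : ∀ {m n} → Matrix m n → Matrix m n → Set
_≡ᴹ_ {m} {n} A B = ∀ (i : Fin m) (j : Fin n) → A i j ≡ B i j

-- Off the diagonal, a row of the corrected Ferrers diagram has n − 1 slots.
-- Reversing both indices (i ↦ n−1−i) reverses the order of these slots, and the
-- complementary sequence fills exactly the slots that d leaves empty, so
-- F(d̄)ᵢⱼ = 1 − F(d)_{ī,ȷ̄} off the diagonal. The constant 1 cancels in the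
-- difference F(d̄)ⱼᵢ − F(d̄)ᵢⱼ, which leaves M(d)_{ȷ̄,ī} = (M(d)⊥)ᵢⱼ.
module Submission where

open import Defs hiding (sym)
open import Data.Nat using (ℕ; zero; suc; _∸_; _<_; _≤_; z≤n; s≤s) renaming (_<ᵇ_ to _<ᵇℕ_)
open import Data.Nat.Properties
  using (≤-pred; ≤-trans; n≤1+n; m∸n≤m; ∸-monoˡ-≤; 0∸n≡0; n∸n≡0; +-∸-assoc; m≤n⇒m<n∨m≡n; <ᵇ⇒<)
open import Data.Integer using (+_)
open import Data.Fin using (Fin; toℕ; opposite)
open import Data.Fin.Properties using (opposite-prop; opposite-involutive; toℕ≤pred[n]; toℕ-injective)
  renaming (_≟_ to _≟ᶠ_)
open import Data.Bool using (Bool; true; false; if_then_else_; not; T)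
open import Data.Sum using (inj₁; inj₂)
open import Data.Empty using (⊥-elim)
open import Function using (_∘′_)
open import Relation.Binary.PropositionalEquality
open import Relation.Nullary using (Dec; yes; no)

<⇒<ᵇ≡true : ∀ {m n} → m < n → (m <ᵇℕ n) ≡ true
<⇒<ᵇ≡true {zero}  (s≤s _)          = refl
<⇒<ᵇ≡true {suc m} (s≤s m<n@(s≤s _)) = <⇒<ᵇ≡true m<n

≤⇒<ᵇ≡false : ∀ {m n} → n ≤ m → (m <ᵇℕ n) ≡ false
≤⇒<ᵇ≡false z≤n       = refl
≤⇒<ᵇ≡false (s≤s n≤m) = ≤⇒<ᵇ≡false n≤m

<ᵇ-∸-complement : ∀ {p k} D → p ≤ k → (p <ᵇℕ (suc k ∸ D)) ≡ not ((k ∸ p) <ᵇℕ D)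
<ᵇ-∸-complement                 zero    p≤k = <⇒<ᵇ≡true (s≤s p≤k)
<ᵇ-∸-complement {k = zero}      (suc D) z≤n rewrite 0∸n≡0 D = refl
<ᵇ-∸-complement {p} {suc k}     (suc D) p≤k with m≤n⇒m<n∨m≡n p≤k
... | inj₁ (s≤s p≤k′) rewrite <ᵇ-∸-complement D p≤k′ | +-∸-assoc 1 p≤k′ = refl
... | inj₂ refl       rewrite ≤⇒<ᵇ≡false (m∸n≤m (suc k) D) | n∸n≡0 k = refl

offDiagPosℕ : ℕ → ℕ → ℕ
offDiagPosℕ a b = if b <ᵇℕ a then b else b ∸ 1

offDiagPos-toℕ : ∀ {n} (i j : Fin n) → offDiagPos i j ≡ offDiagPosℕ (toℕ i) (toℕ j)
offDiagPos-toℕ i j with toℕ j <ᵇℕ toℕ i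
... | true  = refl
... | false = refl

offDiagPosℕ-suc : ∀ a b → a ≢ b → offDiagPosℕ (suc a) (suc b) ≡ suc (offDiagPosℕ a b)
offDiagPosℕ-suc a       b       a≢b with b <ᵇℕ a in b<a
... | true = refl
offDiagPosℕ-suc zero    zero    a≢b | false = ⊥-elim (a≢b refl)
offDiagPosℕ-suc (suc a) zero    a≢b | false with () ← b<a
offDiagPosℕ-suc a       (suc b) a≢b | false = refl

offDiagPosℕ-≤ : ∀ {a b k} → a ≤ suc k → b ≤ suc k → offDiagPosℕ a b ≤ k
offDiagPosℕ-≤ {a} {b} a≤1+k b≤1+k with b <ᵇℕ a in b<a
... | true  = ≤-pred (≤-trans (<ᵇ⇒< b a (subst T (sym b<a) _)) a≤1+k)
... | false = ∸-monoˡ-≤ 1 b≤1+k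

offDiagPosℕ-reverse : ∀ {a b} k → a ≤ suc k → b ≤ suc k → a ≢ b →
  offDiagPosℕ (suc k ∸ a) (suc k ∸ b) ≡ k ∸ offDiagPosℕ a b
offDiagPosℕ-reverse {zero}  {zero}  k       _         _         a≢b = ⊥-elim (a≢b refl)
offDiagPosℕ-reverse {zero}  {suc b} k       _         (s≤s b≤k) _
  rewrite <⇒<ᵇ≡true (s≤s (m∸n≤m k b)) = refl
offDiagPosℕ-reverse {suc a} {zero}  k       (s≤s a≤k) _         _
  rewrite ≤⇒<ᵇ≡false (≤-trans (m∸n≤m k a) (n≤1+n k)) = refl
offDiagPosℕ-reverse {suc a} {suc b} zero    (s≤s z≤n) (s≤s z≤n) a≢b = ⊥-elim (a≢b refl)
offDiagPosℕ-reverse {suc a} {suc b} (suc k) (s≤s a≤k) (s≤s b≤k) a≢b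
  rewrite offDiagPosℕ-suc a b (a≢b ∘′ cong suc) = offDiagPosℕ-reverse k a≤k b≤k (a≢b ∘′ cong suc)

indicator : Bool → Entry
indicator b = if b then num (+ 1) else num (+ 0)

-ᵉ-indicator-not : ∀ x y → (indicator (not x) -ᵉ indicator (not y)) ≡ (indicator y -ᵉ indicator x)
-ᵉ-indicator-not true  true  = refl
-ᵉ-indicator-not true  false = refl
-ᵉ-indicator-not false true  = refl
-ᵉ-indicator-not false false = refl

ferrers-diag : ∀ {n} (d : Seq n) i → ferrers d i i ≡ star
ferrers-diag d i with i ≟ᶠ i
... | yes _   = refl
... | no i≢i  = ⊥-elim (i≢i refl)

ferrers-offDiag : ∀ {n} (d : Seq n) {i j} → i ≢ j → ferrers d i j ≡ indicator (offDiagPos i j <ᵇℕ d i)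
ferrers-offDiag d {i} {j} i≢j with i ≟ᶠ j
... | yes i≡j = ⊥-elim (i≢j i≡j)
... | no  _   = refl

opposite-≢ : ∀ {n} {i j : Fin n} → i ≢ j → opposite i ≢ opposite j
opposite-≢ {i = i} {j} i≢j i′≡j′ =
  i≢j (trans (sym (opposite-involutive i)) (trans (cong opposite i′≡j′) (opposite-involutive j)))

ferrers-complement-offDiag : ∀ {k} (d : Seq (suc (suc k))) {i j} → i ≢ j →
  ferrers (complement d) i j ≡ indicator (not (offDiagPos (opposite i) (opposite j) <ᵇℕ d (opposite i)))
ferrers-complement-offDiag {k} d {i} {j} i≢j
  rewrite ferrers-offDiag (complement d) i≢j
        | offDiagPos-toℕ i j | offDiagPos-toℕ (opposite i) (opposite j)
        | opposite-prop i | opposite-prop j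
        | offDiagPosℕ-reverse k (toℕ≤pred[n] i) (toℕ≤pred[n] j) (i≢j ∘′ toℕ-injective)
        | <ᵇ-∸-complement (d (opposite i)) (offDiagPosℕ-≤ (toℕ≤pred[n] i) (toℕ≤pred[n] j))
  = refl

diffMatrix-complement-offDiag : ∀ {n} (d : Seq n) {i j} → i ≢ j →
  diffMatrix (complement d) i j ≡ antiTranspose (diffMatrix d) i j
diffMatrix-complement-offDiag {suc zero}    d {Fin.zero} {Fin.zero} i≢j = ⊥-elim (i≢j refl)
diffMatrix-complement-offDiag {suc (suc k)} d {i} {j} i≢j
  rewrite ferrers-complement-offDiag d (i≢j ∘′ sym) | ferrers-complement-offDiag d i≢j
        | ferrers-offDiag d (opposite-≢ i≢j) | ferrers-offDiag d (opposite-≢ (i≢j ∘′ sym))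
  = -ᵉ-indicator-not _ _

diffMatrix-complement-diag : ∀ {n} (d : Seq n) i →
  diffMatrix (complement d) i i ≡ antiTranspose (diffMatrix d) i i
diffMatrix-complement-diag d i rewrite ferrers-diag (complement d) i | ferrers-diag d (opposite i) = refl

lemma3p1 : (n : ℕ) (d : Seq n) → IsDegreeSequence d →
    diffMatrix (complement d) ≡ᴹ antiTranspose (diffMatrix d)
lemma3p1 n d _ i j = byCases (i ≟ᶠ j)
  where
  byCases : Dec (i ≡ j) → diffMatrix (complement d) i j ≡ antiTranspose (diffMatrix d) i j
  byCases (yes refl) = diffMatrix-complement-diag d i
  byCases (no i≢j)   = diffMatrix-complement-offDiag d i≢j
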